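{- For every integer $d\ge 2$, $\mu(Q_d)\le 2\,\mu(Q_{d-1})$.
   Context: For a connected graph $G$ and $X\subseteq V(G)$, two vertices $x,y\in V(G)$ are $X$-visible if there is a shortest $x,y$-path none of whose internal vertices lies in $X$. $X$ is a mutual-visibility set if every two vertices of $X$ are $X$-visible; $\mu(G)$ is the maximum cardinality of a mutual-visibility set of $G$. The hypercube $Q_d$ has vertex set $\{0,1\}^d$, two binary strings being adjacent if and only if they differ in exactly one position. -}

module Defs where

open import Data.Bool using (Bool)
open import Data.Nat using (ℕ; zero; suc; _≤_)
open import Data.Fin using (Fin)
open import Data.Vec using (Vec; lookup)
open import Data.List using (List; length)
open import Data.List.Membership.Propositional using (_∈_)
open import Data.List.Relation.Unary.Unique.Propositional using (Unique)
open import Data.Product using (Σ; ∃; _×_)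
open import Data.Sum using (_⊎_)
open import Data.Empty using (⊥)
open import Relation.Nullary using (¬_)
open import Relation.Binary.PropositionalEquality using (_≡_; _≢_)

V : ℕ → Set
V d = Vec Bool d

Adj : ∀ {d} → V d → V d → Set
Adj {d} x y = Σ (Fin d) λ i →
  (lookup x i ≢ lookup y i) × (∀ j → j ≢ i → lookup x j ≡ lookup y j)

data Path {d : ℕ} : V d → V d → Set where
  [_]    : (x : V d) → Path x x
  _∷⟨_⟩_ : ∀ {y z} (x : V d) → Adj x y → Path y z → Path x z

len : ∀ {d} {x y : V d} → Path x y → ℕ
len [ x ]          = 0
len (x ∷⟨ a ⟩ p)   = suc (len p)

NonLast : ∀ {d} {x y : V d} → Path x y → V d → Set
NonLast [ x ]        v = ⊥
NonLast (x ∷⟨ a ⟩ p) v = v ≡ x ⊎ NonLast p v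

Internal : ∀ {d} {x y : V d} → Path x y → V d → Set
Internal [ x ]        v = ⊥
Internal (x ∷⟨ a ⟩ p) v = NonLast p v

Shortest : ∀ {d} {x y : V d} → Path x y → Set
Shortest {d} {x} {y} p = ∀ (q : Path x y) → len p ≤ len q

Visible : ∀ {d} → List (V d) → V d → V d → Set
Visible {d} X x y = Σ (Path x y) λ p →
  Shortest p × (∀ v → Internal p v → ¬ (v ∈ X))

MutualVisibility : ∀ {d} → List (V d) → Set
MutualVisibility X = ∀ {x y} → x ∈ X → y ∈ X → Visible X x y

-- "m = μ(Q_d)": m is the maximum cardinality of a mutual-visibility set
-- (sets represented as duplicate-free lists, cardinality = length).
IsMu : ℕ → ℕ → Set
IsMu d m =
  (Σ (List (V d)) λ X → Unique X × MutualVisibility X × length X ≡ m)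
  × (∀ (X : List (V d)) → Unique X → MutualVisibility X → length X ≤ m)

-- Split a mutual-visibility set X of Q_(d+1) by its first coordinate into two halves,
-- each a copy of a subset of Q_d. Projecting away the first coordinate shortens paths
-- by the number of steps that flip it, and a path inside one half can be lifted back
-- without changing its length; so a shortest path between two vertices of one half
-- never flips the first coordinate, stays in that half, and projects to a shortest path
-- whose internal vertices avoid the projected half. Each half is therefore a
-- mutual-visibility set of Q_d, and |X| ≤ 2 μ(Q_d).
module Submission where

open import Defs
open import Data.Nat using (ℕ; suc; _≤_; _*_)
open import Data.Nat using (_+_)
open import Data.Nat.Properties
  using (+-suc; +-identityʳ; +-cancelˡ-≤; n≤0⇒n≡0; m≤m+n; ≤-trans; +-mono-≤)
open import Data.Bool using (Bool; true; false; _≟_)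
open import Data.Fin using (Fin) renaming (zero to fz; suc to fs)
open import Data.Fin.Properties using () renaming (suc-injective to fs-injective)
open import Data.Vec using (_∷_; lookup; tail; tabulate)
open import Data.Vec.Properties using (tabulate∘lookup; tabulate-cong)
open import Data.List using (List; []; _∷_; length)
open import Data.List.Membership.Propositional using (_∈_)
open import Data.List.Relation.Unary.Any using (here; there)
open import Data.List.Relation.Unary.All as All using ()
open import Data.List.Relation.Unary.AllPairs using ([]; _∷_)
open import Data.List.Relation.Unary.Unique.Propositional using (Unique)
open import Data.Product using (Σ; _×_; _,_)
open import Data.Sum using (inj₁; inj₂)
open import Data.Empty using (⊥)
open import Function using (_∘′_)
open import Relation.Nullary using (yes; no)
open import Relation.Binary.PropositionalEquality

private
  variable
    n : ℕ

tail-≡ : (x y : V (suc n)) → (∀ j → j ≢ fz → lookup x j ≡ lookup y j) → tail x ≡ tail y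
tail-≡ (_ ∷ xs) (_ ∷ ys) agree = begin
  xs                    ≡⟨ tabulate∘lookup xs ⟨
  tabulate (lookup xs)  ≡⟨ tabulate-cong (λ k → agree (fs k) λ ()) ⟩
  tabulate (lookup ys)  ≡⟨ tabulate∘lookup ys ⟩
  ys                    ∎
  where open ≡-Reasoning

tail-adj : (x y : V (suc n)) (k : Fin n) → lookup x (fs k) ≢ lookup y (fs k) →
  (∀ j → j ≢ fs k → lookup x j ≡ lookup y j) → Adj (tail x) (tail y)
tail-adj (_ ∷ _) (_ ∷ _) k differ agree =
  k , differ , λ j j≢k → agree (fs j) (j≢k ∘′ fs-injective)

cons-adj : (b : Bool) {xs ys : V n} → Adj xs ys → Adj (b ∷ xs) (b ∷ ys)
cons-adj b (k , differ , agree) = fs k , differ , agree′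
  where
  agree′ : ∀ j → j ≢ fs k → lookup (b ∷ _) j ≡ lookup (b ∷ _) j
  agree′ fz     _      = refl
  agree′ (fs j) j≢fs-k = agree j (λ j≡k → j≢fs-k (cong fs j≡k))

cast : {a b c : V n} → a ≡ b → Path b c → Path a c
cast refl p = p

len-cast : {a b c : V n} (e : a ≡ b) (p : Path b c) → len (cast e p) ≡ len p
len-cast refl p = refl

internal-cast : {a b c : V n} (e : a ≡ b) (p : Path b c) {v : V n} →
  Internal (cast e p) v → Internal p v
internal-cast refl p i = i

nonLast-cast : {a b c : V n} (e : a ≡ b) (p : Path b c) {v : V n} →
  NonLast (cast e p) v → NonLast p v
nonLast-cast refl p i = i

internal⇒nonLast : {x y : V n} (p : Path x y) {v : V n} → Internal p v → NonLast p v
internal⇒nonLast (x ∷⟨ _ ⟩ p) i = inj₂ i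

flips : {x y : V (suc n)} → Path x y → ℕ
flips [ x ]                 = 0
flips (x ∷⟨ fz , _ ⟩ p)   = suc (flips p)
flips (x ∷⟨ fs _ , _ ⟩ p) = flips p

project : {x y : V (suc n)} → Path x y → Path (tail x) (tail y)
project [ x ] = [ tail x ]
project (_∷⟨_⟩_ {y = y} x (fz , _ , agree) p) = cast (tail-≡ x y agree) (project p)
project (_∷⟨_⟩_ {y = y} x (fs k , differ , agree) p) =
  tail x ∷⟨ tail-adj x y k differ agree ⟩ project p

len-project : {x y : V (suc n)} (p : Path x y) → len (project p) + flips p ≡ len p
len-project [ x ] = refl
len-project (_∷⟨_⟩_ {y = y} x (fz , _ , agree) p) = begin
  len (cast (tail-≡ x y agree) (project p)) + suc (flips p)
    ≡⟨ cong (_+ suc (flips p)) (len-cast (tail-≡ x y agree) (project p)) ⟩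
  len (project p) + suc (flips p)  ≡⟨ +-suc (len (project p)) (flips p) ⟩
  suc (len (project p) + flips p)  ≡⟨ cong suc (len-project p) ⟩
  suc (len p)                      ∎
  where open ≡-Reasoning
len-project (x ∷⟨ fs _ , _ ⟩ p) = cong suc (len-project p)

len-project≤len : {x y : V (suc n)} (p : Path x y) → len (project p) ≤ len p
len-project≤len p = subst (len (project p) ≤_) (len-project p) (m≤m+n _ _)

nonLast-project : {x y : V (suc n)} (p : Path x y) {v′ : V n} → NonLast (project p) v′ →
  Σ (V (suc n)) λ v → NonLast p v × tail v ≡ v′
nonLast-project (_∷⟨_⟩_ {y = y} x (fz , _ , agree) p) v′∈
  with v , v∈ , refl ← nonLast-project p (nonLast-cast (tail-≡ x y agree) (project p) v′∈)
  = v , inj₂ v∈ , refl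
nonLast-project (x ∷⟨ fs _ , _ ⟩ p) (inj₁ refl) = x , inj₁ refl , refl
nonLast-project (x ∷⟨ fs _ , _ ⟩ p) (inj₂ v′∈)
  with v , v∈ , refl ← nonLast-project p v′∈
  = v , inj₂ v∈ , refl

internal-project : {x y : V (suc n)} (p : Path x y) {v′ : V n} → Internal (project p) v′ →
  Σ (V (suc n)) λ v → Internal p v × tail v ≡ v′
internal-project (_∷⟨_⟩_ {y = y} x (fz , _ , agree) p) v′∈
  with v , v∈ , refl ← internal-project p (internal-cast (tail-≡ x y agree) (project p) v′∈)
  = v , internal⇒nonLast p v∈ , refl
internal-project (x ∷⟨ fs _ , _ ⟩ p) v′∈ = nonLast-project p v′∈

lift : (b : Bool) {xs ys : V n} → Path xs ys → Path (b ∷ xs) (b ∷ ys)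
lift b [ xs ]         = [ b ∷ xs ]
lift b (xs ∷⟨ a ⟩ p) = (b ∷ xs) ∷⟨ cons-adj b a ⟩ lift b p

len-lift : (b : Bool) {xs ys : V n} (p : Path xs ys) → len (lift b p) ≡ len p
len-lift b [ _ ]         = refl
len-lift b (_ ∷⟨ _ ⟩ p) = cong suc (len-lift b p)

shortest⇒shortest-project : (b : Bool) {xs ys : V n} (p : Path (b ∷ xs) (b ∷ ys)) →
  Shortest p → Shortest (project p)
shortest⇒shortest-project b p shortest q =
  ≤-trans (len-project≤len p) (subst (len p ≤_) (len-lift b q) (shortest (lift b q)))

shortest⇒flips≡0 : (b : Bool) {xs ys : V n} (p : Path (b ∷ xs) (b ∷ ys)) →
  Shortest p → flips p ≡ 0
shortest⇒flips≡0 b p shortest = n≤0⇒n≡0 (+-cancelˡ-≤ (len (project p)) (flips p) 0 bound)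
  where
  bound : len (project p) + flips p ≤ len (project p) + 0
  bound = subst₂ _≤_ (sym (len-project p)) (trans (len-lift b (project p)) (sym (+-identityʳ _)))
            (shortest (lift b (project p)))

flips≡0⇒nonLast-first : {x y : V (suc n)} (p : Path x y) → flips p ≡ 0 →
  {v : V (suc n)} → NonLast p v → lookup v fz ≡ lookup x fz
flips≡0⇒nonLast-first (x ∷⟨ fs _ , _ ⟩ p) _ (inj₁ refl) = refl
flips≡0⇒nonLast-first (x ∷⟨ fs _ , _ , agree ⟩ p) noFlip (inj₂ v∈) =
  trans (flips≡0⇒nonLast-first p noFlip v∈) (sym (agree fz λ ()))

half : Bool → List (V (suc n)) → List (V n)
half b [] = []
half b ((c ∷ xs) ∷ X) with b ≟ c
... | yes _ = xs ∷ half b X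
... | no _  = half b X

∈-half⇒∈ : (b : Bool) (X : List (V (suc n))) {xs : V n} → xs ∈ half b X → (b ∷ xs) ∈ X
∈-half⇒∈ b ((c ∷ ys) ∷ X) xs∈ with b ≟ c | xs∈
... | yes refl | here refl = here refl
... | yes refl | there xs∈′ = there (∈-half⇒∈ b X xs∈′)
... | no _     | xs∈′       = there (∈-half⇒∈ b X xs∈′)

length-halves : (X : List (V (suc n))) → length X ≡ length (half false X) + length (half true X)
length-halves [] = refl
length-halves ((false ∷ _) ∷ X) = cong suc (length-halves X)
length-halves ((true ∷ _) ∷ X)  = trans (cong suc (length-halves X)) (sym (+-suc _ _))

unique-half : (b : Bool) (X : List (V (suc n))) → Unique X → Unique (half b X)
unique-half b [] [] = []
unique-half b ((c ∷ ys) ∷ X) (distinct ∷ unique) with b ≟ c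
... | yes refl = All.tabulate (λ xs∈ e → All.lookup distinct (∈-half⇒∈ b X xs∈) (cong (b ∷_) e))
                   ∷ unique-half b X unique
... | no _     = unique-half b X unique

mutualVisibility-half : (b : Bool) (X : List (V (suc n))) →
  MutualVisibility X → MutualVisibility (half b X)
mutualVisibility-half b X visible xs∈ ys∈
  with p , shortest , avoids ← visible (∈-half⇒∈ b X xs∈) (∈-half⇒∈ b X ys∈) =
  project p , shortest⇒shortest-project b p shortest , avoids′
  where
  avoids′ : ∀ v′ → Internal (project p) v′ → v′ ∈ half b X → ⊥
  avoids′ v′ v′∈p v′∈X
    with c ∷ v′ , v∈p , refl ← internal-project p v′∈p
    with refl ← flips≡0⇒nonLast-first p (shortest⇒flips≡0 b p shortest) (internal⇒nonLast p v∈p)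
    = avoids (c ∷ v′) v∈p (∈-half⇒∈ c X v′∈X)

corollary1 : ∀ (n : ℕ) → 1 ≤ n → ∀ (m m′ : ℕ) →
    IsMu (suc n) m → IsMu n m′ → m ≤ 2 * m′
corollary1 n _ m m′ ((X , unique , visible , refl) , _) (_ , maximal) =
  subst₂ _≤_ (sym (length-halves X)) (cong (m′ +_) (sym (+-identityʳ m′)))
    (+-mono-≤ (maximal _ (unique-half false X unique) (mutualVisibility-half false X visible))
              (maximal _ (unique-half true X unique) (mutualVisibility-half true X visible)))
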